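{- Let $A$ be an fMV-algebra and $(V,u)$ an fu-algebra such that $A\cong\Gamma_f(V,u)$. Then $A$ is semiprime if and only if $V$ is semiprime.
   Context: An fMV-algebra is a structure $(A,\oplus,\cdot,{}^*,\{\alpha\}_{\alpha\in[0,1]},0)$ where $(A,\oplus,{}^*,0)$ is an MV-algebra (with $x\odot y=(x^*\oplus y^*)^*$, $x\le y$ iff $x\odot y^*=0$, lattice order, $x\wedge y=x\odot(x^*\oplus y)$), $\cdot$ is associative and the unary operations $x\mapsto\alpha x$ satisfy: $z\cdot(x\odot(x\wedge y)^*)=(z\cdot x)\odot(z\cdot(x\wedge y))^*$, $(x\odot(x\wedge y)^*)\cdot z=(x\cdot z)\odot((x\wedge y)\cdot z)^*$, $x\wedge y=0\Rightarrow(x\cdot z)\wedge y=(z\cdot x)\wedge y=0$, $\alpha(x\odot y^*)=(\alpha x)\odot(\alpha y)^*$, $\max(0,\alpha-\beta)x=(\alpha x)\odot(\beta x)^*$, $\alpha(\beta x)=(\alpha\beta)x$, $1x=x$, $\alpha(x\cdot y)=(\alpha x)\cdot y=x\cdot(\alpha y)$. An f-algebra is a real Riesz space with an associative bilinear product making it a lattice-ordered ring with $x\wedge y=0,\ z\ge0\Rightarrow(xz)\wedge y=(zx)\wedge y=0$ and $r(xy)=(rx)y=x(ry)$ for $r\in\mathbb R$. An fu-algebra is a pair $(V,u)$ with $V$ an f-algebra and $u$ a strong unit ($u>0$ and every $x\le nu$ for some $n\in\mathbb N$) with $u\cdot u\le u$. $\Gamma_f(V,u)$ is $\{x\in V:0\le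 x\le u\}$ with $x\oplus y=u\wedge(x+y)$, $x^*=u-x$, $0$, the restricted product and scalar multiplication by $\alpha\in[0,1]$. An fMV-algebra (resp. f-algebra) is semiprime if $x^n=x\cdot\ldots\cdot x=0$ for some $n\ge1$ implies $x=0$. -}

module Defs where

open import Data.Nat using (ℕ; zero; suc)
open import Data.Product using (Σ; ∃; _×_; _,_)
open import Relation.Binary.PropositionalEquality using (_≡_)
open import Relation.Nullary using (¬_)
open import Data.Sum using (_⊎_)

-- The real numbers, axiomatised as a Dedekind-complete ordered field.
-- (agda-stdlib has no reals; all such fields are isomorphic.)

record RealField : Set₁ where
  infixl 6 _+_ _-_
  infixl 7 _*_
  infix 4 _≤_
  field
    Carrier : Set
    0ℝ 1ℝ : Carrier
    _+_ _*_ : Carrier → Carrier → Carrier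
    -_ : Carrier → Carrier
    _⁻¹ : (x : Carrier) → ¬ (x ≡ 0ℝ) → Carrier
    _≤_ : Carrier → Carrier → Set
    +-assoc : ∀ x y z → (x + y) + z ≡ x + (y + z)
    +-comm : ∀ x y → x + y ≡ y + x
    +-identityʳ : ∀ x → x + 0ℝ ≡ x
    +-inverseʳ : ∀ x → x + (- x) ≡ 0ℝ
    *-assoc : ∀ x y z → (x * y) * z ≡ x * (y * z)
    *-comm : ∀ x y → x * y ≡ y * x
    *-identityʳ : ∀ x → x * 1ℝ ≡ x
    *-inverseʳ : ∀ x (p : ¬ (x ≡ 0ℝ)) → x * (x ⁻¹) p ≡ 1ℝ
    distribˡ : ∀ x y z → x * (y + z) ≡ x * y + x * z
    0≢1 : ¬ (0ℝ ≡ 1ℝ)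
    ≤-refl : ∀ x → x ≤ x
    ≤-antisym : ∀ {x y} → x ≤ y → y ≤ x → x ≡ y
    ≤-trans : ∀ {x y z} → x ≤ y → y ≤ z → x ≤ z
    ≤-total : ∀ x y → (x ≤ y) ⊎ (y ≤ x)
    +-mono-≤ : ∀ {x y} z → x ≤ y → x + z ≤ y + z
    *-nonneg : ∀ {x y} → 0ℝ ≤ x → 0ℝ ≤ y → 0ℝ ≤ x * y
    sup : (P : Carrier → Set) → (∃ λ x → P x) →
          (∃ λ b → ∀ x → P x → x ≤ b) →
          ∃ λ s → (∀ x → P x → x ≤ s) ×
                  (∀ b → (∀ x → P x → x ≤ b) → s ≤ b)
  _-_ : Carrier → Carrier → Carrier
  x - y = x + (- y)
  InUnit : Carrier → Set
  InUnit α = (0ℝ ≤ α) × (α ≤ 1ℝ)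

module _ (R : RealField) where
  private module ℝ = RealField R
  open ℝ using (0ℝ; 1ℝ; InUnit)

  record FMVAlgebra : Set₁ where
    infixl 6 _⊕_
    infixl 7 _·_ _⊙_
    field
      Carrier : Set
      _⊕_ : Carrier → Carrier → Carrier
      _* : Carrier → Carrier
      𝟘 : Carrier
      _·_ : Carrier → Carrier → Carrier
      -- scalar multiplication; only the values for α ∈ [0,1] matter
      -- (all axioms below are required only for α, β ∈ [0,1])
      _∙_ : ℝ.Carrier → Carrier → Carrier
    _⊙_ : Carrier → Carrier → Carrier
    x ⊙ y = ((x *) ⊕ (y *)) *
    _≤_ : Carrier → Carrier → Set
    x ≤ y = x ⊙ (y *) ≡ 𝟘
    _∧_ : Carrier → Carrier → Carrier
    x ∧ y = x ⊙ ((x *) ⊕ y)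
    field
      ⊕-assoc : ∀ x y z → x ⊕ (y ⊕ z) ≡ (x ⊕ y) ⊕ z
      ⊕-comm : ∀ x y → x ⊕ y ≡ y ⊕ x
      ⊕-identityʳ : ∀ x → x ⊕ 𝟘 ≡ x
      **-involutive : ∀ x → (x *) * ≡ x
      ⊕-absorb : ∀ x → x ⊕ (𝟘 *) ≡ 𝟘 *
      luk : ∀ x y → ((x *) ⊕ y) * ⊕ y ≡ ((y *) ⊕ x) * ⊕ x
      ·-assoc : ∀ x y z → (x · y) · z ≡ x · (y · z)
      ·-distˡ : ∀ x y z → z · (x ⊙ ((x ∧ y) *)) ≡ (z · x) ⊙ ((z · (x ∧ y)) *)
      ·-distʳ : ∀ x y z → (x ⊙ ((x ∧ y) *)) · z ≡ (x · z) ⊙ (((x ∧ y) · z) *)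
      ·-f : ∀ x y z → x ∧ y ≡ 𝟘 → ((x · z) ∧ y ≡ 𝟘) × ((z · x) ∧ y ≡ 𝟘)
      ∙-dist : ∀ α → InUnit α → ∀ x y → α ∙ (x ⊙ (y *)) ≡ (α ∙ x) ⊙ ((α ∙ y) *)
      ∙-sub≥ : ∀ α β → InUnit α → InUnit β → β ℝ.≤ α →
               ∀ x → (α ℝ.- β) ∙ x ≡ (α ∙ x) ⊙ ((β ∙ x) *)
      ∙-sub≤ : ∀ α β → InUnit α → InUnit β → α ℝ.≤ β →
               ∀ x → 0ℝ ∙ x ≡ (α ∙ x) ⊙ ((β ∙ x) *)
      ∙-assoc : ∀ α β → InUnit α → InUnit β → ∀ x → α ∙ (β ∙ x) ≡ (α ℝ.* β) ∙ x
      ∙-identity : ∀ x → 1ℝ ∙ x ≡ x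
      ∙-· : ∀ α → InUnit α → ∀ x y →
            (α ∙ (x · y) ≡ (α ∙ x) · y) × (α ∙ (x · y) ≡ x · (α ∙ y))

    -- x ^ (suc n) = x · ... · x  (n+1 factors)
    pow : ℕ → Carrier → Carrier
    pow zero x = x
    pow (suc n) x = pow n x · x

  SemiprimeMV : FMVAlgebra → Set
  SemiprimeMV A = ∀ x (n : ℕ) → pow n x ≡ 𝟘 → x ≡ 𝟘
    where open FMVAlgebra A

  record FAlgebra : Set₁ where
    infixl 6 _+_
    infixl 7 _*_ _·_
    infix 4 _≤_
    field
      Carrier : Set
      _+_ : Carrier → Carrier → Carrier
      -_ : Carrier → Carrier
      𝟎 : Carrier
      _·_ : ℝ.Carrier → Carrier → Carrier
      _*_ : Carrier → Carrier → Carrier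
      _≤_ : Carrier → Carrier → Set
      _∧_ _∨_ : Carrier → Carrier → Carrier
      +-assoc : ∀ x y z → (x + y) + z ≡ x + (y + z)
      +-comm : ∀ x y → x + y ≡ y + x
      +-identityʳ : ∀ x → x + 𝟎 ≡ x
      +-inverseʳ : ∀ x → x + (- x) ≡ 𝟎
      ·-distˡ : ∀ r x y → r · (x + y) ≡ r · x + r · y
      ·-distʳ : ∀ r s x → (r ℝ.+ s) · x ≡ r · x + s · x
      ·-assoc : ∀ r s x → (r ℝ.* s) · x ≡ r · (s · x)
      ·-identity : ∀ x → 1ℝ · x ≡ x
      ≤-refl : ∀ x → x ≤ x
      ≤-antisym : ∀ {x y} → x ≤ y → y ≤ x → x ≡ y
      ≤-trans : ∀ {x y z} → x ≤ y → y ≤ z → x ≤ z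
      ∧-lb : ∀ x y → (x ∧ y ≤ x) × (x ∧ y ≤ y)
      ∧-glb : ∀ {x y z} → z ≤ x → z ≤ y → z ≤ x ∧ y
      ∨-ub : ∀ x y → (x ≤ x ∨ y) × (y ≤ x ∨ y)
      ∨-lub : ∀ {x y z} → x ≤ z → y ≤ z → x ∨ y ≤ z
      +-mono-≤ : ∀ {x y} z → x ≤ y → x + z ≤ y + z
      ·-mono-≤ : ∀ {x y} r → 0ℝ ℝ.≤ r → x ≤ y → r · x ≤ r · y
      *-assoc : ∀ x y z → (x * y) * z ≡ x * (y * z)
      *-distˡ : ∀ x y z → x * (y + z) ≡ x * y + x * z
      *-distʳ : ∀ x y z → (y + z) * x ≡ y * x + z * x
      *-· : ∀ r x y → (r · (x * y) ≡ (r · x) * y) × (r · (x * y) ≡ x * (r · y))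
      *-nonneg : ∀ {x y} → 𝟎 ≤ x → 𝟎 ≤ y → 𝟎 ≤ x * y
      f-cond : ∀ x y z → x ∧ y ≡ 𝟎 → 𝟎 ≤ z →
               ((x * z) ∧ y ≡ 𝟎) × ((z * x) ∧ y ≡ 𝟎)

    _-_ : Carrier → Carrier → Carrier
    x - y = x + (- y)

    _•_ : ℕ → Carrier → Carrier
    zero • x = 𝟎
    suc n • x = x + n • x

    pow : ℕ → Carrier → Carrier
    pow zero x = x
    pow (suc n) x = pow n x * x

  SemiprimeF : FAlgebra → Set
  SemiprimeF V = ∀ x (n : ℕ) → pow n x ≡ 𝟎 → x ≡ 𝟎
    where open FAlgebra V

  record FUAlgebra : Set₁ where
    field
      V : FAlgebra
    open FAlgebra V
    field
      u : Carrier
      u-pos : (𝟎 ≤ u) × ¬ (u ≡ 𝟎)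
      u-strong : ∀ x → ∃ λ (n : ℕ) → x ≤ n • u
      u*u≤u : u * u ≤ u

  record IsoΓf (A : FMVAlgebra) (W : FUAlgebra) : Set where
    private
      module A = FMVAlgebra A
      open FUAlgebra W
      module V = FAlgebra V
    field
      f : A.Carrier → V.Carrier
      f-range : ∀ a → (V.𝟎 V.≤ f a) × (f a V.≤ u)
      f-inj : ∀ a b → f a ≡ f b → a ≡ b
      f-surj : ∀ x → V.𝟎 V.≤ x → x V.≤ u → ∃ λ a → f a ≡ x
      f-⊕ : ∀ a b → f (a A.⊕ b) ≡ u V.∧ (f a V.+ f b)
      f-* : ∀ a → f (a A.*) ≡ u V.- f a
      f-𝟘 : f A.𝟘 ≡ V.𝟎
      f-· : ∀ a b → f (a A.· b) ≡ f a V.* f b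
      f-∙ : ∀ α → InUnit α → ∀ a → f (α A.∙ a) ≡ α V.· f a

module Submission where

-- Under the isomorphism f : A ≅ Γ_f(V,u), products and powers
-- of A are computed in V, so a nilpotent element of A is a nilpotent
-- element of V lying in [0,u].  Hence V semiprime ⇒ A semiprime at once.
-- Conversely, assume A is semiprime, so every nilpotent of V in [0,u] is 0.
--   * Strong unit: a nilpotent y ≥ 0 gives the nilpotent y ∧ u ∈ [0,u]
--     (powers are monotone on the positive cone), so y ∧ u = 0; as y is
--     below some n·u, disjointness from u forces y = 0.
--   * f-algebra: writing x = x⁺ - x⁻ with x⁺ ∧ x⁻ = 0, the f-condition
--     gives x⁻ x⁺ = 0, so xⁿ x⁺ = (x⁺)ⁿ⁺¹; thus xⁿ = 0 makes x⁺ nilpotent,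
--     and likewise x⁻ = (-x)⁺, whence x = 0.
-- The file first develops the needed facts about an arbitrary f-algebra
-- (module FAlgebraFacts), then about an fu-algebra (StrongUnitFacts),
-- then about Γ_f (GammaFacts); the proposition combines them.

open import Defs
open import Data.Product using (_×_; _,_; proj₁; proj₂)
open import Data.Sum using (_⊎_; inj₁; inj₂)
open import Data.Nat using (zero; suc)
open import Relation.Binary.PropositionalEquality

module FAlgebraFacts {R : RealField} (V : FAlgebra R) where
  open FAlgebra V
  open ≡-Reasoning

  -- An f-algebra is "reduced on its positive cone" when it has no nonzero
  -- positive nilpotent elements; this is the intermediate notion through
  -- which semiprimeness of V is established.
  NoPositiveNilpotents : Set
  NoPositiveNilpotents = ∀ y n → 𝟎 ≤ y → pow n y ≡ 𝟎 → y ≡ 𝟎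

  +-identityˡ : ∀ x → 𝟎 + x ≡ x
  +-identityˡ x = trans (+-comm 𝟎 x) (+-identityʳ x)

  +-inverseˡ : ∀ x → - x + x ≡ 𝟎
  +-inverseˡ x = trans (+-comm (- x) x) (+-inverseʳ x)

  +-cancel-neg : ∀ x y → (x + y) - y ≡ x
  +-cancel-neg x y = begin
    (x + y) + - y  ≡⟨ +-assoc x y (- y) ⟩
    x + (y + - y)  ≡⟨ cong (x +_) (+-inverseʳ y) ⟩
    x + 𝟎          ≡⟨ +-identityʳ x ⟩
    x              ∎

  neg-cancel-+ : ∀ x y → (x - y) + y ≡ x
  neg-cancel-+ x y = begin
    (x + - y) + y  ≡⟨ +-assoc x (- y) y ⟩
    x + (- y + y)  ≡⟨ cong (x +_) (+-inverseˡ y) ⟩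
    x + 𝟎          ≡⟨ +-identityʳ x ⟩
    x              ∎

  neg-unique : ∀ s t → s + t ≡ 𝟎 → s ≡ - t
  neg-unique s t e = begin
    s              ≡⟨ sym (+-cancel-neg s t) ⟩
    (s + t) + - t  ≡⟨ cong (_+ - t) e ⟩
    𝟎 + - t        ≡⟨ +-identityˡ (- t) ⟩
    - t            ∎

  neg-involutive : ∀ x → - (- x) ≡ x
  neg-involutive x = sym (neg-unique x (- x) (+-inverseʳ x))

  neg-zero : - 𝟎 ≡ 𝟎
  neg-zero = sym (neg-unique 𝟎 𝟎 (+-identityʳ 𝟎))

  +-cancelʳ : ∀ {x y} z → x + z ≡ y + z → x ≡ y
  +-cancelʳ {x} {y} z e =
    trans (sym (+-cancel-neg x z)) (trans (cong (_+ - z) e) (+-cancel-neg y z))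

  +-monoʳ-≤ : ∀ {x y} z → x ≤ y → z + x ≤ z + y
  +-monoʳ-≤ {x} {y} z h = subst₂ _≤_ (+-comm x z) (+-comm y z) (+-mono-≤ z h)

  neg-antitone : ∀ {x y} → x ≤ y → - y ≤ - x
  neg-antitone {x} {y} h = subst₂ _≤_ lhs (+-identityʳ (- x)) shifted
    where
    shifted : - x + (x + - y) ≤ - x + 𝟎
    shifted = +-monoʳ-≤ (- x) (subst (x + - y ≤_) (+-inverseʳ y) (+-mono-≤ (- y) h))
    lhs : - x + (x + - y) ≡ - y
    lhs = trans (sym (+-assoc (- x) x (- y)))
                (trans (cong (_+ - y) (+-inverseˡ x)) (+-identityˡ (- y)))

  sub-nonneg : ∀ {a b} → a ≤ b → 𝟎 ≤ b - a
  sub-nonneg {a} {b} h = subst (_≤ b - a) (+-inverseʳ a) (+-mono-≤ (- a) h)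

  +-nonneg : ∀ {a b} → 𝟎 ≤ a → 𝟎 ≤ b → 𝟎 ≤ a + b
  +-nonneg {a} {b} ha hb =
    ≤-trans (subst (_≤ a + 𝟎) (+-identityʳ 𝟎) (+-mono-≤ 𝟎 ha)) (+-monoʳ-≤ a hb)

  ≤-+-nonneg : ∀ a {c} → 𝟎 ≤ c → a ≤ a + c
  ≤-+-nonneg a {c} hc = subst (_≤ a + c) (+-identityʳ a) (+-monoʳ-≤ a hc)

  ∧-comm : ∀ x y → x ∧ y ≡ y ∧ x
  ∧-comm x y = ≤-antisym (∧-glb (proj₂ (∧-lb x y)) (proj₁ (∧-lb x y)))
                         (∧-glb (proj₂ (∧-lb y x)) (proj₁ (∧-lb y x)))

  ∨-comm : ∀ x y → x ∨ y ≡ y ∨ x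
  ∨-comm x y = ≤-antisym (∨-lub (proj₂ (∨-ub y x)) (proj₁ (∨-ub y x)))
                         (∨-lub (proj₂ (∨-ub x y)) (proj₁ (∨-ub x y)))

  ∧-idem : ∀ x → x ∧ x ≡ x
  ∧-idem x = ≤-antisym (proj₁ (∧-lb x x)) (∧-glb (≤-refl x) (≤-refl x))

  ∧-zero-nonneg : ∀ {y} → 𝟎 ≤ y → y ∧ 𝟎 ≡ 𝟎
  ∧-zero-nonneg hy = ≤-antisym (proj₂ (∧-lb _ 𝟎)) (∧-glb hy (≤-refl 𝟎))

  ∧-translate : ∀ a b c → (a ∧ b) + c ≡ (a + c) ∧ (b + c)
  ∧-translate a b c = ≤-antisym below above
    where
    m = (a + c) ∧ (b + c)
    below = ∧-glb (+-mono-≤ c (proj₁ (∧-lb a b))) (+-mono-≤ c (proj₂ (∧-lb a b)))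
    m-c≤a : m - c ≤ a
    m-c≤a = subst (m - c ≤_) (+-cancel-neg a c) (+-mono-≤ (- c) (proj₁ (∧-lb (a + c) (b + c))))
    m-c≤b : m - c ≤ b
    m-c≤b = subst (m - c ≤_) (+-cancel-neg b c) (+-mono-≤ (- c) (proj₂ (∧-lb (a + c) (b + c))))
    above = subst (_≤ (a ∧ b) + c) (neg-cancel-+ m c) (+-mono-≤ c (∧-glb m-c≤a m-c≤b))

  ∨-translate : ∀ a b c → (a ∨ b) + c ≡ (a + c) ∨ (b + c)
  ∨-translate a b c = ≤-antisym below above
    where
    M = (a + c) ∨ (b + c)
    above = ∨-lub (+-mono-≤ c (proj₁ (∨-ub a b))) (+-mono-≤ c (proj₂ (∨-ub a b)))
    a≤M-c : a ≤ M - c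
    a≤M-c = subst (_≤ M - c) (+-cancel-neg a c) (+-mono-≤ (- c) (proj₁ (∨-ub (a + c) (b + c))))
    b≤M-c : b ≤ M - c
    b≤M-c = subst (_≤ M - c) (+-cancel-neg b c) (+-mono-≤ (- c) (proj₂ (∨-ub (a + c) (b + c))))
    below = subst ((a ∨ b) + c ≤_) (neg-cancel-+ M c) (+-mono-≤ c (∨-lub a≤M-c b≤M-c))

  neg-∨ : ∀ a b → - (a ∨ b) ≡ (- a) ∧ (- b)
  neg-∨ a b = ≤-antisym
    (∧-glb (neg-antitone (proj₁ (∨-ub a b))) (neg-antitone (proj₂ (∨-ub a b))))
    (subst (_≤ - (a ∨ b)) (neg-involutive k) (neg-antitone (∨-lub a≤-k b≤-k)))
    where
    k = (- a) ∧ (- b)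
    a≤-k : a ≤ - k
    a≤-k = subst (_≤ - k) (neg-involutive a) (neg-antitone (proj₁ (∧-lb (- a) (- b))))
    b≤-k : b ≤ - k
    b≤-k = subst (_≤ - k) (neg-involutive b) (neg-antitone (proj₂ (∧-lb (- a) (- b))))

  ∧-disjoint-+ : ∀ {a b c} → 𝟎 ≤ a → 𝟎 ≤ b → 𝟎 ≤ c →
                 a ∧ b ≡ 𝟎 → a ∧ c ≡ 𝟎 → a ∧ (b + c) ≡ 𝟎
  ∧-disjoint-+ {a} {b} {c} ha hb hc ab ac = ≤-antisym w≤0 (∧-glb ha (+-nonneg hb hc))
    where
    w = a ∧ (b + c)
    w≤a = proj₁ (∧-lb a (b + c))
    -- w ≤ (a + c) ∧ (b + c) = (a ∧ b) + c = c
    w≤c : w ≤ c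
    w≤c = subst (w ≤_)
      (trans (sym (∧-translate a b c)) (trans (cong (_+ c) ab) (+-identityˡ c)))
      (∧-glb (≤-trans w≤a (≤-+-nonneg a hc)) (proj₂ (∧-lb a (b + c))))
    w≤0 = subst (w ≤_) ac (∧-glb w≤a w≤c)

  infix 30 _⁺ _⁻

  _⁺ : Carrier → Carrier
  x ⁺ = x ∨ 𝟎

  _⁻ : Carrier → Carrier
  x ⁻ = (- x) ⁺

  ⁺-nonneg : ∀ x → 𝟎 ≤ x ⁺
  ⁺-nonneg x = proj₂ (∨-ub x 𝟎)

  ⁺≡+⁻ : ∀ x → x ⁺ ≡ x + x ⁻
  ⁺≡+⁻ x = sym (begin
    x + (- x) ⁺            ≡⟨ +-comm x _ ⟩
    ((- x) ∨ 𝟎) + x        ≡⟨ ∨-translate (- x) 𝟎 x ⟩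
    (- x + x) ∨ (𝟎 + x)    ≡⟨ cong₂ _∨_ (+-inverseˡ x) (+-identityˡ x) ⟩
    𝟎 ∨ x                  ≡⟨ ∨-comm 𝟎 x ⟩
    x ⁺                    ∎)

  ⁺-⁻-decomposition : ∀ x → x ≡ x ⁺ - x ⁻
  ⁺-⁻-decomposition x =
    sym (trans (cong (_- x ⁻) (⁺≡+⁻ x)) (+-cancel-neg x (x ⁻)))

  ∧-zero≡-⁻ : ∀ x → x ∧ 𝟎 ≡ - (x ⁻)
  ∧-zero≡-⁻ x = sym (trans (neg-∨ (- x) 𝟎) (cong₂ _∧_ (neg-involutive x) neg-zero))

  ⁺-⁻-disjoint : ∀ x → x ⁺ ∧ x ⁻ ≡ 𝟎
  ⁺-⁻-disjoint x = begin
    x ⁺ ∧ q                ≡⟨ cong₂ _∧_ (⁺≡+⁻ x) (sym (+-identityˡ q)) ⟩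
    (x + q) ∧ (𝟎 + q)      ≡⟨ sym (∧-translate x 𝟎 q) ⟩
    (x ∧ 𝟎) + q            ≡⟨ cong (_+ q) (∧-zero≡-⁻ x) ⟩
    - q + q                ≡⟨ +-inverseˡ q ⟩
    𝟎                      ∎
    where q = x ⁻

  zero-* : ∀ x → 𝟎 * x ≡ 𝟎
  zero-* x = +-cancelʳ (𝟎 * x)
    (trans (sym (*-distʳ x 𝟎 𝟎)) (trans (cong (_* x) (+-identityʳ 𝟎)) (sym (+-identityˡ _))))

  *-zero : ∀ x → x * 𝟎 ≡ 𝟎
  *-zero x = +-cancelʳ (x * 𝟎)
    (trans (sym (*-distˡ x 𝟎 𝟎)) (trans (cong (x *_) (+-identityʳ 𝟎)) (sym (+-identityˡ _))))

  neg-*ˡ : ∀ a b → (- a) * b ≡ - (a * b)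
  neg-*ˡ a b = neg-unique _ _
    (trans (sym (*-distʳ b (- a) a)) (trans (cong (_* b) (+-inverseˡ a)) (zero-* b)))

  neg-*ʳ : ∀ a b → a * (- b) ≡ - (a * b)
  neg-*ʳ a b = neg-unique _ _
    (trans (sym (*-distˡ a (- b) b)) (trans (cong (a *_) (+-inverseˡ b)) (*-zero a)))

  *-monoʳ-≤ : ∀ {a b c} → 𝟎 ≤ c → a ≤ b → a * c ≤ b * c
  *-monoʳ-≤ {a} {b} {c} hc h =
    subst₂ _≤_ (+-identityˡ (a * c)) (neg-cancel-+ (b * c) (a * c))
      (+-mono-≤ (a * c) (subst (𝟎 ≤_) distrib (*-nonneg (sub-nonneg h) hc)))
    where
    distrib : (b - a) * c ≡ (b * c) - (a * c)
    distrib = trans (*-distʳ c b (- a)) (cong (b * c +_) (neg-*ˡ a c))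

  *-monoˡ-≤ : ∀ {a b c} → 𝟎 ≤ c → a ≤ b → c * a ≤ c * b
  *-monoˡ-≤ {a} {b} {c} hc h =
    subst₂ _≤_ (+-identityˡ (c * a)) (neg-cancel-+ (c * b) (c * a))
      (+-mono-≤ (c * a) (subst (𝟎 ≤_) distrib (*-nonneg hc (sub-nonneg h))))
    where
    distrib : c * (b - a) ≡ (c * b) - (c * a)
    distrib = trans (*-distˡ c b (- a)) (cong (c * b +_) (neg-*ʳ c a))

  disjoint-product : ∀ {p q} → 𝟎 ≤ p → 𝟎 ≤ q → p ∧ q ≡ 𝟎 → q * p ≡ 𝟎
  disjoint-product {p} {q} hp hq pq =
    trans (sym (∧-idem (q * p))) (proj₁ (f-cond q (q * p) p q⊥qp hp))
    where
    q⊥qp : q ∧ (q * p) ≡ 𝟎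
    q⊥qp = trans (∧-comm q (q * p)) (proj₂ (f-cond p q q pq hq))

  pow-nonneg : ∀ {y} n → 𝟎 ≤ y → 𝟎 ≤ pow n y
  pow-nonneg zero h = h
  pow-nonneg (suc n) h = *-nonneg (pow-nonneg n h) h

  pow-mono : ∀ {a b} n → 𝟎 ≤ a → a ≤ b → pow n a ≤ pow n b
  pow-mono zero ha h = h
  pow-mono (suc n) ha h =
    ≤-trans (*-monoʳ-≤ ha (pow-mono n ha h)) (*-monoˡ-≤ (pow-nonneg n (≤-trans ha h)) h)

  pow-neg : ∀ x n → (pow n (- x) ≡ pow n x) ⊎ (pow n (- x) ≡ - pow n x)
  pow-neg x zero = inj₂ refl
  pow-neg x (suc n) with pow-neg x n
  ... | inj₁ e = inj₂ (trans (neg-*ʳ _ _) (cong (λ t → - (t * x)) e))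
  ... | inj₂ e = inj₁ (trans (neg-*ʳ _ _)
                  (trans (cong (λ t → - (t * x)) e)
                  (trans (cong -_ (neg-*ˡ _ _)) (neg-involutive _))))

  nilpotent-neg : ∀ x n → pow n x ≡ 𝟎 → pow n (- x) ≡ 𝟎
  nilpotent-neg x n e with pow-neg x n
  ... | inj₁ h = trans h e
  ... | inj₂ h = trans h (trans (cong -_ e) neg-zero)

  pow-absorb : ∀ {x p} → x * p ≡ p * p → ∀ n → pow n x * p ≡ pow (suc n) p
  pow-absorb e zero = e
  pow-absorb {x} {p} e (suc n) = begin
    (pow n x * x) * p    ≡⟨ *-assoc _ _ _ ⟩
    pow n x * (x * p)    ≡⟨ cong (pow n x *_) e ⟩
    pow n x * (p * p)    ≡⟨ sym (*-assoc _ _ _) ⟩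
    (pow n x * p) * p    ≡⟨ cong (_* p) (pow-absorb e n) ⟩
    pow (suc n) p * p    ∎

  -- x x⁺ = x⁺ x⁺, since x⁻ x⁺ = 0 by the f-condition.
  *-⁺ : ∀ x → x * x ⁺ ≡ x ⁺ * x ⁺
  *-⁺ x = begin
    x * p                   ≡⟨ cong (_* p) (⁺-⁻-decomposition x) ⟩
    (p - q) * p             ≡⟨ *-distʳ p p (- q) ⟩
    p * p + (- q) * p       ≡⟨ cong (p * p +_) q*p≡0 ⟩
    p * p + 𝟎               ≡⟨ +-identityʳ _ ⟩
    p * p                   ∎
    where
    p = x ⁺
    q = x ⁻
    q*p≡0 : (- q) * p ≡ 𝟎
    q*p≡0 = trans (neg-*ˡ q p)
      (trans (cong -_ (disjoint-product (⁺-nonneg x) (⁺-nonneg (- x)) (⁺-⁻-disjoint x)))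
             neg-zero)

  ⁺-nilpotent : ∀ x n → pow n x ≡ 𝟎 → pow (suc n) (x ⁺) ≡ 𝟎
  ⁺-nilpotent x n e =
    trans (sym (pow-absorb (*-⁺ x) n)) (trans (cong (_* x ⁺) e) (zero-* (x ⁺)))

  semiprime-from-positive : NoPositiveNilpotents → SemiprimeF R V
  semiprime-from-positive reduced x n e = begin
    x                ≡⟨ ⁺-⁻-decomposition x ⟩
    x ⁺ - x ⁻        ≡⟨ cong₂ _-_ x⁺≡0 x⁻≡0 ⟩
    𝟎 - 𝟎            ≡⟨ cong (𝟎 +_) neg-zero ⟩
    𝟎 + 𝟎            ≡⟨ +-identityʳ 𝟎 ⟩
    𝟎                ∎
    where
    x⁺≡0 : x ⁺ ≡ 𝟎
    x⁺≡0 = reduced (x ⁺) (suc n) (⁺-nonneg x) (⁺-nilpotent x n e)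
    x⁻≡0 : x ⁻ ≡ 𝟎
    x⁻≡0 = reduced (x ⁻) (suc n) (⁺-nonneg (- x)) (⁺-nilpotent (- x) n (nilpotent-neg x n e))

module StrongUnitFacts {R : RealField} (W : FUAlgebra R) where
  open FUAlgebra W
  open FAlgebra V
  open FAlgebraFacts V

  0≤u : 𝟎 ≤ u
  0≤u = proj₁ u-pos

  •u-nonneg : ∀ k → 𝟎 ≤ k • u
  •u-nonneg zero = ≤-refl 𝟎
  •u-nonneg (suc k) = +-nonneg 0≤u (•u-nonneg k)

  -- A positive element disjoint from the strong unit is zero: it is then
  -- disjoint from every k·u, and it lies below one of them.
  disjoint-from-unit : ∀ {y} → 𝟎 ≤ y → y ∧ u ≡ 𝟎 → y ≡ 𝟎
  disjoint-from-unit {y} hy y⊥u = trans (sym y∧nu≡y) (disjoint-multiples n)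
    where
    n = proj₁ (u-strong y)
    y∧nu≡y : y ∧ (n • u) ≡ y
    y∧nu≡y = ≤-antisym (proj₁ (∧-lb y _)) (∧-glb (≤-refl y) (proj₂ (u-strong y)))
    disjoint-multiples : ∀ k → y ∧ (k • u) ≡ 𝟎
    disjoint-multiples zero = ∧-zero-nonneg hy
    disjoint-multiples (suc k) =
      ∧-disjoint-+ hy 0≤u (•u-nonneg k) y⊥u (disjoint-multiples k)

  -- If no nonzero element of [0,u] is nilpotent, V has no positive
  -- nilpotents: for nilpotent y ≥ 0, the element y ∧ u ∈ [0,u] is nilpotent.
  no-positive-nilpotents :
    (∀ w n → 𝟎 ≤ w → w ≤ u → pow n w ≡ 𝟎 → w ≡ 𝟎) → NoPositiveNilpotents
  no-positive-nilpotents interval-reduced y n hy yⁿ≡0 =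
    disjoint-from-unit hy (interval-reduced w n 0≤w (proj₂ (∧-lb y u)) wⁿ≡0)
    where
    w = y ∧ u
    0≤w = ∧-glb hy 0≤u
    wⁿ≡0 : pow n w ≡ 𝟎
    wⁿ≡0 = ≤-antisym (subst (pow n w ≤_) yⁿ≡0 (pow-mono n 0≤w (proj₁ (∧-lb y u))))
                     (pow-nonneg n 0≤w)

module GammaFacts {R : RealField} {A : FMVAlgebra R} {W : FUAlgebra R}
                  (iso : IsoΓf R A W) where
  module A = FMVAlgebra A
  open FUAlgebra W
  open FAlgebra V
  open IsoΓf iso

  f-pow : ∀ n a → f (A.pow n a) ≡ pow n (f a)
  f-pow zero a = refl
  f-pow (suc n) a = trans (f-· _ _) (cong (_* f a) (f-pow n a))

  interval-reduced : SemiprimeMV R A →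
    ∀ w n → 𝟎 ≤ w → w ≤ u → pow n w ≡ 𝟎 → w ≡ 𝟎
  interval-reduced semiprimeA w n 0≤w w≤u wⁿ≡0 =
    trans (sym fa≡w) (trans (cong f (semiprimeA a n aⁿ≡0)) f-𝟘)
    where
    a = proj₁ (f-surj w 0≤w w≤u)
    fa≡w = proj₂ (f-surj w 0≤w w≤u)
    aⁿ≡0 : A.pow n a ≡ A.𝟘
    aⁿ≡0 = f-inj _ _
      (trans (f-pow n a) (trans (cong (pow n) fa≡w) (trans wⁿ≡0 (sym f-𝟘))))

  semiprime-reflect : SemiprimeF R V → SemiprimeMV R A
  semiprime-reflect semiprimeV a n aⁿ≡0 = f-inj a A.𝟘
    (trans (semiprimeV (f a) n (trans (sym (f-pow n a)) (trans (cong f aⁿ≡0) f-𝟘)))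
           (sym f-𝟘))

proposition3p8 : (R : RealField) (A : FMVAlgebra R) (W : FUAlgebra R) →
    IsoΓf R A W →
    (SemiprimeMV R A → SemiprimeF R (FUAlgebra.V W)) ×
    (SemiprimeF R (FUAlgebra.V W) → SemiprimeMV R A)
proposition3p8 R A W iso = semiprime-lift , semiprime-reflect
  where
  open GammaFacts iso
  semiprime-lift : SemiprimeMV R A → SemiprimeF R (FUAlgebra.V W)
  semiprime-lift semiprimeA =
    FAlgebraFacts.semiprime-from-positive (FUAlgebra.V W)
      (StrongUnitFacts.no-positive-nilpotents W (interval-reduced semiprimeA))
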